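{- There exist a finite signature of binary relation symbols and a first-order sentence $\chi$ over it such that $\chi$ is preserved under taking generated subframes over finite frames, but $\chi$ is not equivalent over finite frames to any $\exists$-bounded first-order sentence.
   Context: A frame is a structure $(W,(R_a)_{a\in A})$ with binary relations only. $F=(W,(R_a))$ is a generated subframe of $G=(W',(R'_a))$ if $F$ is an induced substructure of $G$ and for all $a$ and $(w,v)\in R'_a$, if $w\in W$ then $v\in W$. $\chi$ is preserved under generated subframes over finite frames if whenever $G$ is a finite frame with $G\models\chi$ and $F$ is a generated subframe of $G$, then $F\models\chi$. A first-order formula is $\exists$-bounded if it is built from literals (atomic formulas, including equalities, and their negations) using $\land$, $\lor$, bounded quantifiers $\exists x(R(y,x)\land\cdots)$ and $\forall x(R(y,x)\to\cdots)$ with $R$ a binary relation symbol and $y$ a variable distinct from $x$, and unbounded universal quantifiers $\forall x$. -}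

module Defs where

open import Data.Nat using (ℕ; suc; _≟_)
open import Data.Fin using (Fin; zero)
open import Data.Bool using (Bool; true)
open import Data.Product using (Σ; _×_; _,_)
open import Data.Sum using (_⊎_)
open import Relation.Nullary using (¬_; yes; no)
open import Relation.Binary.PropositionalEquality using (_≡_; _≢_)
open import Function.Bundles using (_⇔_)
open import Function.Definitions using (Injective)

Var : Set
Var = ℕ

data Formula (k : ℕ) : Set where
  rel   : Fin k → Var → Var → Formula k
  _≐_   : Var → Var → Formula k
  ¬ᶠ_   : Formula k → Formula k
  _∧ᶠ_  : Formula k → Formula k → Formula k
  _∨ᶠ_  : Formula k → Formula k → Formula k
  _⇒ᶠ_  : Formula k → Formula k → Formula k
  ∃ᶠ    : Var → Formula k → Formula k
  ∀ᶠ    : Var → Formula k → Formula k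

data Free {k : ℕ} (x : Var) : Formula k → Set where
  rel₁ : ∀ {a y} → Free x (rel a x y)
  rel₂ : ∀ {a y} → Free x (rel a y x)
  eq₁  : ∀ {y} → Free x (x ≐ y)
  eq₂  : ∀ {y} → Free x (y ≐ x)
  neg  : ∀ {φ} → Free x φ → Free x (¬ᶠ φ)
  and₁ : ∀ {φ ψ} → Free x φ → Free x (φ ∧ᶠ ψ)
  and₂ : ∀ {φ ψ} → Free x ψ → Free x (φ ∧ᶠ ψ)
  or₁  : ∀ {φ ψ} → Free x φ → Free x (φ ∨ᶠ ψ)
  or₂  : ∀ {φ ψ} → Free x ψ → Free x (φ ∨ᶠ ψ)
  imp₁ : ∀ {φ ψ} → Free x φ → Free x (φ ⇒ᶠ ψ)
  imp₂ : ∀ {φ ψ} → Free x ψ → Free x (φ ⇒ᶠ ψ)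
  ex   : ∀ {y φ} → x ≢ y → Free x φ → Free x (∃ᶠ y φ)
  all  : ∀ {y φ} → x ≢ y → Free x φ → Free x (∀ᶠ y φ)

Sentence : {k : ℕ} → Formula k → Set
Sentence φ = ∀ x → ¬ Free x φ

-- A finite frame: nonempty finite domain Fin (suc size) and k binary relations
-- (given as Boolean-valued, i.e. decidable, relations).
record Frame (k : ℕ) : Set where
  field
    size : ℕ
    R    : Fin k → Fin (suc size) → Fin (suc size) → Bool
open Frame public

W : {k : ℕ} → Frame k → Set
W F = Fin (suc (size F))

_[_↦_] : {A : Set} → (Var → A) → Var → A → Var → A
(ρ [ x ↦ w ]) z with z ≟ x
... | yes _ = w
... | no  _ = ρ z

Sat : {k : ℕ} (F : Frame k) → (Var → W F) → Formula k → Set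
Sat F ρ (rel a x y) = R F a (ρ x) (ρ y) ≡ true
Sat F ρ (x ≐ y)     = ρ x ≡ ρ y
Sat F ρ (¬ᶠ φ)      = ¬ Sat F ρ φ
Sat F ρ (φ ∧ᶠ ψ)    = Sat F ρ φ × Sat F ρ ψ
Sat F ρ (φ ∨ᶠ ψ)    = Sat F ρ φ ⊎ Sat F ρ ψ
Sat F ρ (φ ⇒ᶠ ψ)    = Sat F ρ φ → Sat F ρ ψ
Sat F ρ (∃ᶠ x φ)    = Σ (W F) λ w → Sat F (ρ [ x ↦ w ]) φ
Sat F ρ (∀ᶠ x φ)    = (w : W F) → Sat F (ρ [ x ↦ w ]) φ

-- Truth of a sentence in a frame (any assignment; we fix the constant one).
_⊨_ : {k : ℕ} → Frame k → Formula k → Set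
F ⊨ φ = Sat F (λ _ → zero) φ

-- F is (isomorphic, via the embedding e, to) a generated subframe of G:
-- e is an injective map which is an induced-substructure embedding and whose
-- image is closed under the successors of every relation.
GeneratedSubframe : {k : ℕ} → Frame k → Frame k → Set
GeneratedSubframe {k} F G =
  Σ (W F → W G) λ e →
    Injective _≡_ _≡_ e
    × (∀ (a : Fin k) (u v : W F) → R F a u v ≡ R G a (e u) (e v))
    × (∀ (a : Fin k) (u : W F) (v : W G) → R G a (e u) v ≡ true →
         Σ (W F) λ u′ → e u′ ≡ v)

PreservedUnderGeneratedSubframes : {k : ℕ} → Formula k → Set
PreservedUnderGeneratedSubframes {k} χ =
  ∀ (F G : Frame k) → GeneratedSubframe F G → G ⊨ χ → F ⊨ χ

data ExistsBounded {k : ℕ} : Formula k → Set where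
  lit-rel  : ∀ {a x y} → ExistsBounded (rel a x y)
  lit-nrel : ∀ {a x y} → ExistsBounded (¬ᶠ rel a x y)
  lit-eq   : ∀ {x y} → ExistsBounded (x ≐ y)
  lit-neq  : ∀ {x y} → ExistsBounded (¬ᶠ (x ≐ y))
  conj     : ∀ {φ ψ} → ExistsBounded φ → ExistsBounded ψ → ExistsBounded (φ ∧ᶠ ψ)
  disj     : ∀ {φ ψ} → ExistsBounded φ → ExistsBounded ψ → ExistsBounded (φ ∨ᶠ ψ)
  bex      : ∀ {a x y φ} → y ≢ x → ExistsBounded φ →
               ExistsBounded (∃ᶠ x (rel a y x ∧ᶠ φ))
  ball     : ∀ {a x y φ} → y ≢ x → ExistsBounded φ →
               ExistsBounded (∀ᶠ x (rel a y x ⇒ᶠ φ))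
  uall     : ∀ {x φ} → ExistsBounded φ → ExistsBounded (∀ᶠ x φ)

EquivalentOverFiniteFrames : {k : ℕ} → Formula k → Formula k → Set
EquivalentOverFiniteFrames {k} χ ψ = ∀ (F : Frame k) → (F ⊨ χ) ⇔ (F ⊨ ψ)

{-# OPTIONS --safe #-}
-- χ says: B-edges are converse S-edges, B-predecessors are unique except at B-terminal points, there is at
-- most one B-terminal point, and either every point has a B-successor or some point has no S-successor.
--
-- Preservation: in a finite frame the B-walk from an S-sink never revisits a point, so it ends at the
-- B-terminal point c, and the reversed walk is an S-path from c to the sink. A generated subframe that is not
-- B-serial has a B-terminal point, which is c, so it contains the sink as well.
--
-- Non-definability: X and Y consist of a root and V + 2 branches of 2^d + 2 points, with S pointing away
-- from the root and B towards it; every branch of Y ends in an S-loop, and so does every branch of X except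
-- branch 0. Thus X ⊨ χ and Y ⊭ χ. Every ∃-bounded sentence of depth d in V variables true in X is true in Y:
-- unbounded quantifiers only occur universally, so only a point of Y is ever chosen freely, and Duplicator
-- answers it on a branch of X that is fresh and nonzero unless a pebble lies near it. With n rounds left,
-- pebbles at distance ≤ 2^n share a branch in X iff they do in Y, and pebbles on branch 0 of X stay more
-- than 2^n away from its loopless end.

module Submission where

open import Defs
open import Data.Nat as ℕ using (ℕ; zero; suc; _≤_; _<_; _+_; _^_; _⊔_; ∣_-_∣; z≤n; s≤s)
open import Data.Nat.Properties
  using (≤-refl; ≤-trans; n≤1+n; n<1+n; m<n⇒m<1+n; <-irrefl; <⇒≱; ≤∧≢⇒<; m⊔n≤o⇒m≤o; m⊔n≤o⇒n≤o;
         m≤m⊔n; m≤n⊔m; anyUpTo?; ≡ᵇ⇒≡; ∣n-n∣≡0; ∣-∣-comm; ∣-∣-triangle; m≤n+∣n-m∣; m+n≤o⇒m≤o;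
         +-mono-≤; +-monoˡ-≤; +-monoʳ-≤; +-assoc; +-identityʳ; ^-monoʳ-≤; m^n>0; module ≤-Reasoning)
open import Data.Fin as Fin using (Fin; zero; suc; toℕ; fromℕ; fromℕ<; inject₁; combine; remQuot)
open import Data.Fin.Properties
  using (any?; all?; ¬∀⟶∃¬; pigeonhole; injective⇒≤; toℕ-injective; toℕ<n; toℕ≤pred[n];
         toℕ-fromℕ; toℕ-fromℕ<; toℕ-inject₁; remQuot-combine; combine-remQuot)
open import Data.Bool using (Bool; true; false; T; _∧_; _∨_)
open import Data.Bool.Properties using (T-∧; T-∨) renaming (_≟_ to _≟ᵇ_)
open import Data.Unit using (⊤; tt)
open import Data.Product using (Σ; ∃; _×_; _,_; proj₁; proj₂; uncurry)
open import Data.Sum using (_⊎_; inj₁; inj₂)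
open import Data.Empty using (⊥; ⊥-elim)
open import Data.Vec.Functional using (_∷_)
open import Function using (_∘_; const)
open import Function.Bundles using (_⇔_; mk⇔; Equivalence)
import Function.Properties.Equivalence as ⇔
open import Relation.Nullary using (¬_; Dec; yes; no; does; ¬?)
open import Relation.Nullary.Decidable using (map′; _×-dec_; decidable-stable)
open import Relation.Binary.PropositionalEquality using (_≡_; _≢_; refl; sym; trans; cong; subst; subst₂)
open import Relation.Binary.Construct.Closure.ReflexiveTransitive using (Star; ε; _◅_; _◅◅_; reverse)

-- Preservation of ∃-bounded formulas

↦-here : ∀ {A : Set} (ρ : Var → A) x w → (ρ [ x ↦ w ]) x ≡ w
↦-here ρ x w with x ℕ.≟ x
... | yes _ = refl
... | no x≢x = ⊥-elim (x≢x refl)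

↦-there : ∀ {A : Set} (ρ : Var → A) {x} w {z} → z ≢ x → (ρ [ x ↦ w ]) z ≡ ρ z
↦-there ρ {x} w {z} z≢x with z ℕ.≟ x
... | yes z≡x = ⊥-elim (z≢x z≡x)
... | no _ = refl

Succ : ∀ {k} (F : Frame k) → Fin k → W F → W F → Set
Succ F a u v = R F a u v ≡ true

HasSucc : ∀ {k} (F : Frame k) → Fin k → W F → Set
HasSucc F a u = Σ (W F) (Succ F a u)

hasSucc? : ∀ {k} (F : Frame k) a u → Dec (HasSucc F a u)
hasSucc? F a u = any? (λ v → R F a u v ≟ᵇ true)

module _ {k : ℕ} where

  depth : Formula k → ℕ
  depth (rel _ _ _) = 0
  depth (_ ≐ _)     = 0
  depth (¬ᶠ φ)      = depth φ
  depth (φ ∧ᶠ ψ)    = depth φ ⊔ depth ψ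
  depth (φ ∨ᶠ ψ)    = depth φ ⊔ depth ψ
  depth (φ ⇒ᶠ ψ)    = depth φ ⊔ depth ψ
  depth (∃ᶠ _ φ)    = suc (depth φ)
  depth (∀ᶠ _ φ)    = suc (depth φ)

  VarsBelow : ℕ → Formula k → Set
  VarsBelow V (rel _ x y) = x < V × y < V
  VarsBelow V (x ≐ y)     = x < V × y < V
  VarsBelow V (¬ᶠ φ)      = VarsBelow V φ
  VarsBelow V (φ ∧ᶠ ψ)    = VarsBelow V φ × VarsBelow V ψ
  VarsBelow V (φ ∨ᶠ ψ)    = VarsBelow V φ × VarsBelow V ψ
  VarsBelow V (φ ⇒ᶠ ψ)    = VarsBelow V φ × VarsBelow V ψ
  VarsBelow V (∃ᶠ x φ)    = x < V × VarsBelow V φ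
  VarsBelow V (∀ᶠ x φ)    = x < V × VarsBelow V φ

  varsBelow-mono : ∀ {U V} (φ : Formula k) → U ≤ V → VarsBelow U φ → VarsBelow V φ
  varsBelow-mono (rel _ _ _) U≤V (x<U , y<U) = ≤-trans x<U U≤V , ≤-trans y<U U≤V
  varsBelow-mono (_ ≐ _)     U≤V (x<U , y<U) = ≤-trans x<U U≤V , ≤-trans y<U U≤V
  varsBelow-mono (¬ᶠ φ)      U≤V h           = varsBelow-mono φ U≤V h
  varsBelow-mono (φ ∧ᶠ ψ)    U≤V (hφ , hψ)   = varsBelow-mono φ U≤V hφ , varsBelow-mono ψ U≤V hψ
  varsBelow-mono (φ ∨ᶠ ψ)    U≤V (hφ , hψ)   = varsBelow-mono φ U≤V hφ , varsBelow-mono ψ U≤V hψ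
  varsBelow-mono (φ ⇒ᶠ ψ)    U≤V (hφ , hψ)   = varsBelow-mono φ U≤V hφ , varsBelow-mono ψ U≤V hψ
  varsBelow-mono (∃ᶠ _ φ)    U≤V (x<U , hφ)  = ≤-trans x<U U≤V , varsBelow-mono φ U≤V hφ
  varsBelow-mono (∀ᶠ _ φ)    U≤V (x<U , hφ)  = ≤-trans x<U U≤V , varsBelow-mono φ U≤V hφ

  varsBelow-join : ∀ (φ ψ : Formula k) → ∃ (λ U → VarsBelow U φ) → ∃ (λ V → VarsBelow V ψ) →
                   ∃ λ W → VarsBelow W φ × VarsBelow W ψ
  varsBelow-join φ ψ (U , hφ) (V , hψ) =
    U ⊔ V , varsBelow-mono φ (m≤m⊔n U V) hφ , varsBelow-mono ψ (m≤n⊔m U V) hψ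

  varsBelow-bind : ∀ x (φ : Formula k) → ∃ (λ V → VarsBelow V φ) → ∃ λ W → x < W × VarsBelow W φ
  varsBelow-bind x φ (V , hφ) = suc x ⊔ V , m≤m⊔n (suc x) V , varsBelow-mono φ (m≤n⊔m (suc x) V) hφ

  varsBelow-exists : (φ : Formula k) → ∃ λ V → VarsBelow V φ
  varsBelow-exists (rel _ x y) = suc x ⊔ suc y , m≤m⊔n (suc x) (suc y) , m≤n⊔m (suc x) (suc y)
  varsBelow-exists (x ≐ y)     = suc x ⊔ suc y , m≤m⊔n (suc x) (suc y) , m≤n⊔m (suc x) (suc y)
  varsBelow-exists (¬ᶠ φ)      = varsBelow-exists φ
  varsBelow-exists (φ ∧ᶠ ψ)    = varsBelow-join φ ψ (varsBelow-exists φ) (varsBelow-exists ψ)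
  varsBelow-exists (φ ∨ᶠ ψ)    = varsBelow-join φ ψ (varsBelow-exists φ) (varsBelow-exists ψ)
  varsBelow-exists (φ ⇒ᶠ ψ)    = varsBelow-join φ ψ (varsBelow-exists φ) (varsBelow-exists ψ)
  varsBelow-exists (∃ᶠ x φ)    = varsBelow-bind x φ (varsBelow-exists φ)
  varsBelow-exists (∀ᶠ x φ)    = varsBelow-bind x φ (varsBelow-exists φ)

R-update⇔ : ∀ {k} (F : Frame k) a (ρ : Var → W F) {x y} u → y ≢ x →
            Succ F a ((ρ [ x ↦ u ]) y) ((ρ [ x ↦ u ]) x) ⇔ Succ F a (ρ y) u
R-update⇔ F a ρ {x} u y≢x = mk⇔ (subst₂ (Succ F a) (↦-there ρ u y≢x) (↦-here ρ x u))
                                (subst₂ (Succ F a) (sym (↦-there ρ u y≢x)) (sym (↦-here ρ x u)))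

-- Inv n is a position with n rounds left. There is no unrestricted forth move since ∃ is always bounded.
record ExistsBoundedSimulation {k} (F G : Frame k) (V : ℕ) : Set₁ where
  field
    Inv       : ℕ → (Var → W F) → (Var → W G) → Set
    rel-agree : ∀ {n ρ σ x y} a → Inv n ρ σ → x < V → y < V → Succ F a (ρ x) (ρ y) ⇔ Succ G a (σ x) (σ y)
    eq-agree  : ∀ {n ρ σ x y} → Inv n ρ σ → x < V → y < V → (ρ x ≡ ρ y) ⇔ (σ x ≡ σ y)
    forth     : ∀ {n ρ σ y u} x a → Inv (suc n) ρ σ → y < V → Succ F a (ρ y) u →
                Σ (W G) λ u′ → Succ G a (σ y) u′ × Inv n (ρ [ x ↦ u ]) (σ [ x ↦ u′ ])
    back      : ∀ {n ρ σ y u′} x a → Inv (suc n) ρ σ → y < V → Succ G a (σ y) u′ →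
                Σ (W F) λ u → Succ F a (ρ y) u × Inv n (ρ [ x ↦ u ]) (σ [ x ↦ u′ ])
    back-any  : ∀ {n ρ σ} x u′ → Inv (suc n) ρ σ → Σ (W F) λ u → Inv n (ρ [ x ↦ u ]) (σ [ x ↦ u′ ])

  preserves : ∀ {φ n ρ σ} → ExistsBounded φ → depth φ ≤ n → VarsBelow V φ → Inv n ρ σ →
              Sat F ρ φ → Sat G σ φ
  preserves lit-rel                  _ (x<V , y<V) inv = Equivalence.to (rel-agree _ inv x<V y<V)
  preserves lit-nrel                 _ (x<V , y<V) inv = λ ¬r r → ¬r (Equivalence.from (rel-agree _ inv x<V y<V) r)
  preserves lit-eq                   _ (x<V , y<V) inv = Equivalence.to (eq-agree inv x<V y<V)
  preserves lit-neq                  _ (x<V , y<V) inv = λ ¬e e → ¬e (Equivalence.from (eq-agree inv x<V y<V) e)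
  preserves (conj {φ} {ψ} eφ eψ) d≤n (vφ , vψ) inv (hφ , hψ) =
    preserves eφ (m⊔n≤o⇒m≤o (depth φ) (depth ψ) d≤n) vφ inv hφ ,
    preserves eψ (m⊔n≤o⇒n≤o (depth φ) (depth ψ) d≤n) vψ inv hψ
  preserves (disj {φ} {ψ} eφ eψ) d≤n (vφ , vψ) inv (inj₁ hφ) =
    inj₁ (preserves eφ (m⊔n≤o⇒m≤o (depth φ) (depth ψ) d≤n) vφ inv hφ)
  preserves (disj {φ} {ψ} eφ eψ) d≤n (vφ , vψ) inv (inj₂ hψ) =
    inj₂ (preserves eψ (m⊔n≤o⇒n≤o (depth φ) (depth ψ) d≤n) vψ inv hψ)
  preserves {ρ = ρ} {σ} (bex {a} y≢x eφ) (s≤s d≤n) (_ , (y<V , _) , vφ) inv (u , r , h)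
    with u′ , r′ , inv′ ← forth _ a inv y<V (Equivalence.to (R-update⇔ F a ρ u y≢x) r) =
    u′ , Equivalence.from (R-update⇔ G a σ u′ y≢x) r′ , preserves eφ d≤n vφ inv′ h
  preserves {ρ = ρ} {σ} (ball {a} y≢x eφ) (s≤s d≤n) (_ , (y<V , _) , vφ) inv h u′ r′
    with u , r , inv′ ← back _ a inv y<V (Equivalence.to (R-update⇔ G a σ u′ y≢x) r′) =
    preserves eφ d≤n vφ inv′ (h u (Equivalence.from (R-update⇔ F a ρ u y≢x) r))
  preserves (uall {x} eφ) (s≤s d≤n) (_ , vφ) inv h u′
    with u , inv′ ← back-any x u′ inv =
    preserves eφ d≤n vφ inv′ (h u)

-- χ and generated subframes

module _ {k : ℕ} where

  allFree : (Var → Bool) → Formula k → Bool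
  allFree p (rel _ x y) = p x ∧ p y
  allFree p (x ≐ y)     = p x ∧ p y
  allFree p (¬ᶠ φ)      = allFree p φ
  allFree p (φ ∧ᶠ ψ)    = allFree p φ ∧ allFree p ψ
  allFree p (φ ∨ᶠ ψ)    = allFree p φ ∧ allFree p ψ
  allFree p (φ ⇒ᶠ ψ)    = allFree p φ ∧ allFree p ψ
  allFree p (∃ᶠ x φ)    = allFree (λ z → (z ℕ.≡ᵇ x) ∨ p z) φ
  allFree p (∀ᶠ x φ)    = allFree (λ z → (z ℕ.≡ᵇ x) ∨ p z) φ

  private
    left : ∀ {a b} → T (a ∧ b) → T a
    left h = proj₁ (Equivalence.to T-∧ h)

    right : ∀ {a b} → T (a ∧ b) → T b
    right h = proj₂ (Equivalence.to T-∧ h)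

    unbind : ∀ {x y b} → x ≢ y → T ((x ℕ.≡ᵇ y) ∨ b) → T b
    unbind {x} {y} x≢y h with Equivalence.to T-∨ h
    ... | inj₁ x≡y = ⊥-elim (x≢y (≡ᵇ⇒≡ x y x≡y))
    ... | inj₂ t   = t

  allFree-sound : ∀ {φ : Formula k} {x} p → Free x φ → T (allFree p φ) → T (p x)
  allFree-sound p rel₁        h = left h
  allFree-sound p rel₂        h = right h
  allFree-sound p eq₁         h = left h
  allFree-sound p eq₂         h = right h
  allFree-sound p (neg fr)    h = allFree-sound p fr h
  allFree-sound p (and₁ fr)   h = allFree-sound p fr (left h)
  allFree-sound p (and₂ fr)   h = allFree-sound p fr (right h)
  allFree-sound p (or₁ fr)    h = allFree-sound p fr (left h)
  allFree-sound p (or₂ fr)    h = allFree-sound p fr (right h)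
  allFree-sound p (imp₁ fr)   h = allFree-sound p fr (left h)
  allFree-sound p (imp₂ fr)   h = allFree-sound p fr (right h)
  allFree-sound p (ex ne fr)  h = unbind ne (allFree-sound _ fr h)
  allFree-sound p (all ne fr) h = unbind ne (allFree-sound _ fr h)

  closed⇒sentence : (φ : Formula k) → T (allFree (const false) φ) → Sentence φ
  closed⇒sentence φ h x fr = allFree-sound (const false) fr h

module GeneratedSubframeProperties {k} (F G : Frame k) (sub : GeneratedSubframe F G) where

  private
    e = proj₁ sub

  embed-injective : ∀ {u v} → e u ≡ e v → u ≡ v
  embed-injective = proj₁ (proj₂ sub)

  succ-preserved : ∀ {a u v} → Succ F a u v → Succ G a (e u) (e v)
  succ-preserved {a} {u} {v} r = trans (sym (proj₁ (proj₂ (proj₂ sub)) a u v)) r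

  succ-reflected : ∀ {a u v} → Succ G a (e u) (e v) → Succ F a u v
  succ-reflected {a} {u} {v} r = trans (proj₁ (proj₂ (proj₂ sub)) a u v) r

  succ-closed : ∀ {a u v} → Succ G a (e u) v → Σ (W F) λ u′ → e u′ ≡ v
  succ-closed {a} {u} {v} = proj₂ (proj₂ (proj₂ sub)) a u v

  hasSucc-reflected : ∀ {a u} → HasSucc G a (e u) → HasSucc F a u
  hasSucc-reflected (v , r) with u′ , refl ← succ-closed r = u′ , succ-reflected r

  star-closed : ∀ {a u v} → Star (Succ G a) (e u) v → Σ (W F) λ u′ → e u′ ≡ v
  star-closed ε       = _ , refl
  star-closed (r ◅ p) with u′ , refl ← succ-closed r = star-closed p

module TerminalReachable {k} (G : Frame k) (b : Fin k)
  (pred-unique : ∀ x y z → Succ G b y x × Succ G b z x → y ≡ z ⊎ ¬ HasSucc G b x)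
  (x₀ : W G) (x₀-source : ∀ y → ¬ Succ G b y x₀) where

  next : W G → W G
  next x with hasSucc? G b x
  ... | yes (y , _) = y
  ... | no _        = x

  next-succ : ∀ x → HasSucc G b x → Succ G b x (next x)
  next-succ x h with hasSucc? G b x
  ... | yes (_ , r) = r
  ... | no ¬h       = ⊥-elim (¬h h)

  next-star : ∀ x → Star (Succ G b) x (next x)
  next-star x with hasSucc? G b x
  ... | yes (_ , r) = r ◅ ε
  ... | no _        = ε

  iterate : ℕ → W G
  iterate zero    = x₀
  iterate (suc i) = next (iterate i)

  walk : ∀ i → Star (Succ G b) x₀ (iterate i)
  walk zero    = ε
  walk (suc i) = walk i ◅◅ next-star (iterate i)

  iterate-distinct : ∀ j → (∀ {i} → i < j → HasSucc G b (iterate i)) →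
                     ∀ {i} → i < j → iterate i ≢ iterate j
  iterate-distinct (suc j) h {zero} _ eq =
    x₀-source (iterate j) (subst (Succ G b (iterate j)) (sym eq) (next-succ _ (h ≤-refl)))
  iterate-distinct (suc j) h {suc i} (s≤s i<j) eq
    with pred-unique (iterate (suc i)) (iterate i) (iterate j)
           (next-succ _ (h (m<n⇒m<1+n i<j)) , subst (Succ G b (iterate j)) (sym eq) (next-succ _ (h ≤-refl)))
  ... | inj₁ same     = iterate-distinct j (λ i<j′ → h (m<n⇒m<1+n i<j′)) i<j same
  ... | inj₂ terminal = terminal (h (s≤s i<j))

  terminal-reachable : Σ (W G) λ c → ¬ HasSucc G b c × Star (Succ G b) x₀ c
  terminal-reachable with anyUpTo? (λ i → ¬? (hasSucc? G b (iterate i))) (suc (size G))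
  ... | yes (i , _ , terminal) = iterate i , terminal , walk i
  ... | no none with i , j , i<j , eq ← pigeonhole (n<1+n (suc (size G))) (λ i → iterate (toℕ i)) =
    ⊥-elim (iterate-distinct (toℕ j) all-succ i<j eq)
    where
    all-succ : ∀ {i} → i < toℕ j → HasSucc G b (iterate i)
    all-succ {i} i<j = decidable-stable (hasSucc? G b (iterate i))
                         (λ terminal → none (i , ≤-trans i<j (toℕ≤pred[n] j) , terminal))

pattern S = zero
pattern B = suc zero

χ-converse χ-injective χ-terminal χ-sink χ : Formula 2
χ-converse  = ∀ᶠ 0 (∀ᶠ 1 (rel B 0 1 ⇒ᶠ rel S 1 0))
χ-injective = ∀ᶠ 0 (∀ᶠ 1 (∀ᶠ 2 ((rel B 1 0 ∧ᶠ rel B 2 0) ⇒ᶠ ((1 ≐ 2) ∨ᶠ (¬ᶠ ∃ᶠ 1 (rel B 0 1))))))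
χ-terminal  = ∀ᶠ 0 (∀ᶠ 1 (((¬ᶠ ∃ᶠ 2 (rel B 0 2)) ∧ᶠ (¬ᶠ ∃ᶠ 2 (rel B 1 2))) ⇒ᶠ (0 ≐ 1)))
χ-sink      = (∀ᶠ 0 (∃ᶠ 1 (rel B 0 1))) ∨ᶠ (∃ᶠ 0 (∀ᶠ 1 (¬ᶠ rel S 0 1)))
χ           = χ-converse ∧ᶠ (χ-injective ∧ᶠ (χ-terminal ∧ᶠ χ-sink))

χ-sentence : Sentence χ
χ-sentence = closed⇒sentence χ _

module _ (F G : Frame 2) (sub : GeneratedSubframe F G) where
  open GeneratedSubframeProperties F G sub
  private
    e = proj₁ sub

  χ-converse-reflected : G ⊨ χ-converse → F ⊨ χ-converse
  χ-converse-reflected g u v r = succ-reflected (g (e u) (e v) (succ-preserved r))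

  χ-injective-reflected : G ⊨ χ-injective → F ⊨ χ-injective
  χ-injective-reflected g x y z (r , r′) with g (e x) (e y) (e z) (succ-preserved r , succ-preserved r′)
  ... | inj₁ same     = inj₁ (embed-injective same)
  ... | inj₂ terminal = inj₂ λ (w , r″) → terminal (e w , succ-preserved r″)

  χ-terminal-reflected : G ⊨ χ-terminal → F ⊨ χ-terminal
  χ-terminal-reflected g x y (tx , ty) =
    embed-injective (g (e x) (e y) ((λ s → tx (hasSucc-reflected s)) , (λ s → ty (hasSucc-reflected s))))

  χ-sink-reflected : G ⊨ χ-converse → G ⊨ χ-injective → G ⊨ χ-terminal → G ⊨ χ-sink → F ⊨ χ-sink
  χ-sink-reflected _ _ _ (inj₁ serial) = inj₁ λ u → hasSucc-reflected (serial (e u))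
  χ-sink-reflected g-conv g-inj g-term (inj₂ (x₀ , sink))
    with all? (hasSucc? F B)
  ... | yes serial = inj₁ serial
  ... | no ¬serial
    with z , z-terminal ← ¬∀⟶∃¬ _ (HasSucc F B) (hasSucc? F B) ¬serial
    with c , c-terminal , path ←
           TerminalReachable.terminal-reachable G B g-inj x₀ (λ y r → sink y (g-conv y x₀ r))
    with refl ← g-term (e z) c ((λ s → z-terminal (hasSucc-reflected s)) , c-terminal)
    with u₀ , refl ← star-closed (reverse (λ {x} {y} → g-conv x y) path) =
    inj₂ (u₀ , λ v r → sink (e v) (succ-preserved r))

χ-preserved : PreservedUnderGeneratedSubframes χ
χ-preserved F G sub (g-conv , g-inj , g-term , g-sink) =
  χ-converse-reflected F G sub g-conv , χ-injective-reflected F G sub g-inj ,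
  χ-terminal-reflected F G sub g-term , χ-sink-reflected F G sub g-conv g-inj g-term g-sink

does≡true⇔ : ∀ {A : Set} (a? : Dec A) → (does a? ≡ true) ⇔ A
does≡true⇔ (yes a) = mk⇔ (λ _ → a) (λ _ → refl)
does≡true⇔ (no ¬a) = mk⇔ (λ ()) (λ a → ⊥-elim (¬a a))

missed-point : ∀ {m n} → n < m → (f : Fin n → Fin m) → ∃ λ j → ∀ i → f i ≢ j
missed-point {m} {n} n<m f with any? (λ j → all? (λ i → ¬? (f i Fin.≟ j)))
... | yes missed = missed
... | no ¬missed = ⊥-elim (<⇒≱ n<m (injective⇒≤ preimage-injective))
  where
  preimage : ∀ j → ∃ λ i → f i ≡ j
  preimage j with i , ¬≢ ← ¬∀⟶∃¬ n _ (λ i → ¬? (f i Fin.≟ j)) (λ none → ¬missed (j , none)) =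
    i , decidable-stable (f i Fin.≟ j) ¬≢

  preimage-injective : ∀ {j j′} → proj₁ (preimage j) ≡ proj₁ (preimage j′) → j ≡ j′
  preimage-injective {j} {j′} eq = trans (sym (proj₂ (preimage j))) (trans (cong f eq) (proj₂ (preimage j′)))

2^n+2^n : ∀ n → 2 ^ n + 2 ^ n ≡ 2 ^ suc n
2^n+2^n n = cong (2 ^ n +_) (sym (+-identityʳ (2 ^ n)))

-- The frames X and Y

module Branches (d V : ℕ) where

  end : ℕ
  end = suc (2 ^ d)

  Branch Pos : Set
  Branch = Fin (suc (suc V))
  Pos    = Fin (suc end)

  data Point : Set where
    root : Point
    at   : Branch → Pos → Point

  data Edge (loops : Branch → Set) : Fin 2 → Point → Point → Set where
    S-root : ∀ {b} → Edge loops S root (at b zero)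
    S-step : ∀ {b p q} → toℕ q ≡ suc (toℕ p) → Edge loops S (at b p) (at b q)
    S-loop : ∀ {b p} → toℕ p ≡ end → loops b → Edge loops S (at b p) (at b p)
    B-root : ∀ {b} → Edge loops B (at b zero) root
    B-step : ∀ {b p q} → toℕ p ≡ suc (toℕ q) → Edge loops B (at b p) (at b q)

  edge? : ∀ {loops} → (∀ b → Dec (loops b)) → ∀ a u v → Dec (Edge loops a u v)
  edge? _ S root root                = no λ ()
  edge? _ S root (at b zero)         = yes S-root
  edge? _ S root (at b (suc p))      = no λ ()
  edge? _ S (at b p) root            = no λ ()
  edge? loops? S (at b p) (at b′ q) with b Fin.≟ b′
  ... | no b≢b′ = no λ { (S-step _) → b≢b′ refl ; (S-loop _ _) → b≢b′ refl }
  ... | yes refl with toℕ q ℕ.≟ suc (toℕ p)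
  ...   | yes e = yes (S-step e)
  ...   | no ¬step with p Fin.≟ q | toℕ p ℕ.≟ end | loops? b
  ...     | yes refl | yes e    | yes l  = yes (S-loop e l)
  ...     | no p≢q   | _        | _      = no λ { (S-step e) → ¬step e ; (S-loop _ _) → p≢q refl }
  ...     | yes refl | no ¬end  | _      = no λ { (S-step e) → ¬step e ; (S-loop e _) → ¬end e }
  ...     | yes refl | yes _    | no ¬l  = no λ { (S-step e) → ¬step e ; (S-loop _ l) → ¬l l }
  edge? _ B root v                   = no λ ()
  edge? _ B (at b zero) root         = yes B-root
  edge? _ B (at b (suc p)) root      = no λ ()
  edge? _ B (at b p) (at b′ q) with b Fin.≟ b′
  ... | no b≢b′ = no λ { (B-step _) → b≢b′ refl }
  ... | yes refl = map′ B-step (λ { (B-step e) → e }) (toℕ p ℕ.≟ suc (toℕ q))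

  N : ℕ
  N = suc (suc V) ℕ.* suc end

  encode : Point → Fin (suc N)
  encode root     = zero
  encode (at b p) = suc (combine b p)

  decode : Fin (suc N) → Point
  decode zero    = root
  decode (suc i) = uncurry at (remQuot (suc end) i)

  decode-encode : ∀ P → decode (encode P) ≡ P
  decode-encode root     = refl
  decode-encode (at b p) = cong (uncurry at) (remQuot-combine b p)

  encode-decode : ∀ u → encode (decode u) ≡ u
  encode-decode zero    = refl
  encode-decode (suc i) = cong suc (combine-remQuot (suc end) i)

  decode-injective : ∀ {u v} → decode u ≡ decode v → u ≡ v
  decode-injective {u} {v} eq = trans (sym (encode-decode u)) (trans (cong encode eq) (encode-decode v))

  decode-≡⇔ : ∀ {u v P Q} → decode u ≡ P → decode v ≡ Q → (u ≡ v) ⇔ (P ≡ Q)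
  decode-≡⇔ refl refl = mk⇔ (cong decode) decode-injective

  frame : (loops : Branch → Set) → (∀ b → Dec (loops b)) → Frame 2
  frame _ loops? = record { size = N ; R = λ a u v → does (edge? loops? a (decode u) (decode v)) }

  root-B-terminal : ∀ {loops} → ¬ Σ Point (Edge loops B root)
  root-B-terminal (_ , ())

  module _ {loops : Branch → Set} (loops? : ∀ b → Dec (loops b)) where

    private
      F = frame loops loops?

    succ⇔edge : ∀ a {u v P Q} → decode u ≡ P → decode v ≡ Q → Succ F a u v ⇔ Edge loops a P Q
    succ⇔edge a {u} {v} refl refl = does≡true⇔ (edge? loops? a (decode u) (decode v))

    hasSucc⇔ : ∀ a {u} → HasSucc F a u ⇔ Σ Point (Edge loops a (decode u))
    hasSucc⇔ a = mk⇔ (λ (v , r) → decode v , Equivalence.to (succ⇔edge a refl refl) r)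
                     (λ (P , e) → encode P , Equivalence.from (succ⇔edge a refl (decode-encode P)) e)

    B-source : ∀ b p → Σ Point (Edge loops B (at b p))
    B-source b zero    = root , B-root
    B-source b (suc p) = at b (inject₁ p) , B-step (cong suc (sym (toℕ-inject₁ p)))

    B-terminal⇒root : ∀ P → ¬ Σ Point (Edge loops B P) → P ≡ root
    B-terminal⇒root root     _         = refl
    B-terminal⇒root (at b p) terminal = ⊥-elim (terminal (B-source b p))

    frame⊨χ-converse : F ⊨ χ-converse
    frame⊨χ-converse u v r =
      Equivalence.from (succ⇔edge S {v} {u} refl refl)
        (converse (Equivalence.to (succ⇔edge B {u} {v} refl refl) r))
      where
      converse : ∀ {P Q} → Edge loops B P Q → Edge loops S Q P
      converse B-root     = S-root
      converse (B-step e) = S-step e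

    B-pred-unique : ∀ {P Q T} → Edge loops B P T → Edge loops B Q T → P ≡ Q ⊎ T ≡ root
    B-pred-unique B-root     B-root      = inj₂ refl
    B-pred-unique (B-step e) (B-step e′) = inj₁ (cong (at _) (toℕ-injective (trans e (sym e′))))

    frame⊨χ-injective : F ⊨ χ-injective
    frame⊨χ-injective x y z (r , r′)
      with B-pred-unique (Equivalence.to (succ⇔edge B {y} {x} refl refl) r)
                         (Equivalence.to (succ⇔edge B {z} {x} refl refl) r′)
    ... | inj₁ same   = inj₁ (decode-injective same)
    ... | inj₂ x-root =
      inj₂ λ s → root-B-terminal
                   (subst (λ T → Σ Point (Edge loops B T)) x-root (Equivalence.to (hasSucc⇔ B) s))

    frame⊨χ-terminal : F ⊨ χ-terminal
    frame⊨χ-terminal x y (tx , ty) =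
      decode-injective (trans (B-terminal⇒root _ (λ s → tx (Equivalence.from (hasSucc⇔ B) s)))
                          (sym (B-terminal⇒root _ (λ s → ty (Equivalence.from (hasSucc⇔ B) s)))))

  X-loops Y-loops : Branch → Set
  X-loops b = b ≢ zero
  Y-loops _ = ⊤

  X-loops? : ∀ b → Dec (X-loops b)
  X-loops? b = ¬? (b Fin.≟ zero)

  Y-loops? : ∀ b → Dec (Y-loops b)
  Y-loops? _ = yes tt

  X Y : Frame 2
  X = frame X-loops X-loops?
  Y = frame Y-loops Y-loops?

  X⊨χ : X ⊨ χ
  X⊨χ = frame⊨χ-converse _ , frame⊨χ-injective _ , frame⊨χ-terminal _ ,
        inj₂ (encode sink , λ v r →
                sink-terminal 
                  (Equivalence.to (succ⇔edge X-loops? S {encode sink} {v} (decode-encode sink) refl) r))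
    where
    sink : Point
    sink = at zero (fromℕ end)

    sink-terminal : ∀ {P} → ¬ Edge X-loops S sink P
    sink-terminal (S-step {q = q} e) =
      <-irrefl refl (subst (_< suc end) (trans e (cong suc (toℕ-fromℕ end))) (toℕ<n q))
    sink-terminal (S-loop _ loop) = loop refl

  Y-S-serial : ∀ P → Σ Point (Edge Y-loops S P)
  Y-S-serial root = at zero zero , S-root
  Y-S-serial (at b p) with toℕ p ℕ.≟ end
  ... | yes p-end = at b p , S-loop p-end tt
  ... | no ¬end   = at b (fromℕ< p+1<) , S-step (toℕ-fromℕ< p+1<)
    where
    p+1< : suc (toℕ p) < suc end
    p+1< = s≤s (≤∧≢⇒< (toℕ≤pred[n] p) ¬end)

  Y⊭χ : ¬ Y ⊨ χ
  Y⊭χ (_ , _ , _ , inj₁ serial) = root-B-terminal (Equivalence.to (hasSucc⇔ Y-loops? B {zero}) (serial zero))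
  Y⊭χ (_ , _ , _ , inj₂ (x₀ , sink)) with P , e ← Y-S-serial (decode x₀) =
    sink (encode P) (Equivalence.from (succ⇔edge Y-loops? S refl (decode-encode P)) e)

  -- Duplicator's strategy

  record Close (n : ℕ) (p q : Pos) : Set where
    constructor close
    field
      distance≤ : ∣ toℕ p - toℕ q ∣ ≤ 2 ^ n

  close? : ∀ n p q → Dec (Close n p q)
  close? n p q = map′ close Close.distance≤ (∣ toℕ p - toℕ q ∣ ℕ.≤? 2 ^ n)

  close-refl : ∀ {n} p → Close n p p
  close-refl {n} p = close (subst (_≤ 2 ^ n) (sym (∣n-n∣≡0 (toℕ p))) z≤n)

  close-sym : ∀ {n p q} → Close n p q → Close n q p
  close-sym {p = p} {q} (close pq) = close (subst (_≤ _) (∣-∣-comm (toℕ p) (toℕ q)) pq)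

  close-adjacent : ∀ {n} {p q : Pos} → toℕ q ≡ suc (toℕ p) → Close n p q
  close-adjacent {n} {p} {q} e = close (subst (_≤ 2 ^ n) (sym distance-one) (m^n>0 2 n))
    where
    ∣m-1+m∣≡1 : ∀ m → ∣ m - suc m ∣ ≡ 1
    ∣m-1+m∣≡1 zero    = refl
    ∣m-1+m∣≡1 (suc m) = ∣m-1+m∣≡1 m

    distance-one : ∣ toℕ p - toℕ q ∣ ≡ 1
    distance-one = trans (cong (∣ toℕ p -_∣) e) (∣m-1+m∣≡1 (toℕ p))

  close-triangle : ∀ {n p q r} → Close n p q → Close n q r → Close (suc n) p r
  close-triangle {n} {p} {q} {r} (close pq) (close qr) = close (begin
    ∣ toℕ p - toℕ r ∣                     ≤⟨ ∣-∣-triangle (toℕ p) (toℕ q) (toℕ r) ⟩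
    ∣ toℕ p - toℕ q ∣ + ∣ toℕ q - toℕ r ∣ ≤⟨ +-mono-≤ pq qr ⟩
    2 ^ n + 2 ^ n                         ≡⟨ 2^n+2^n n ⟩
    2 ^ suc n                             ∎)
    where open ≤-Reasoning

  data Match : Set where
    roots : Match
    pair  : Branch → Branch → Pos → Match

  inX inY : Match → Point
  inX roots        = root
  inX (pair α _ p) = at α p
  inY roots        = root
  inY (pair _ β p) = at β p

  Coherent : ℕ → Match → Match → Set
  Coherent n (pair α β p) (pair α′ β′ q) = Close n p q → (α ≡ α′) ⇔ (β ≡ β′)
  Coherent n _            _              = ⊤

  SinkSafe : ℕ → Match → Set
  SinkSafe n (pair zero _ p) = toℕ p + 2 ^ n ≤ 2 ^ d
  SinkSafe n _               = ⊤

  record Compatible (n : ℕ) (π : Var → Match) (P : Match) : Set where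
    constructor compatible
    field
      coherent : ∀ {w} → w < V → Coherent n P (π w)
      sinkSafe : SinkSafe n P

  Good : ℕ → (Var → Match) → Set
  Good n π = ∀ {v} → v < V → Compatible n π (π v)

  coherent-refl : ∀ {n} P → Coherent n P P
  coherent-refl roots        = tt
  coherent-refl (pair _ _ _) = λ _ → mk⇔ (λ _ → refl) (λ _ → refl)

  coherent-sym : ∀ {n} P Q → Coherent n P Q → Coherent n Q P
  coherent-sym roots        roots        _   = tt
  coherent-sym roots        (pair _ _ _) _   = tt
  coherent-sym (pair _ _ _) roots        _   = tt
  coherent-sym (pair _ _ _) (pair _ _ _) coh qp =
    mk⇔ (sym ∘ Equivalence.to (coh (close-sym qp)) ∘ sym)
        (sym ∘ Equivalence.from (coh (close-sym qp)) ∘ sym)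

  coherent-shift : ∀ {n α β p q} R → Close n p q → Coherent (suc n) (pair α β p) R → Coherent n (pair α β q) R
  coherent-shift roots        _  _   = tt
  coherent-shift (pair _ _ _) pq coh qr = coh (close-triangle pq qr)

  sinkSafe-shift : ∀ {n p q} α β → Close n p q → SinkSafe (suc n) (pair α β p) → SinkSafe n (pair α β q)
  sinkSafe-shift (suc _) _ _ _ = tt
  sinkSafe-shift {n} {p} {q} zero _ (close pq) safe = begin
    toℕ q + 2 ^ n                         ≤⟨ +-monoˡ-≤ (2 ^ n) (m≤n+∣n-m∣ (toℕ q) (toℕ p)) ⟩
    toℕ p + ∣ toℕ p - toℕ q ∣ + 2 ^ n     ≤⟨ +-monoˡ-≤ (2 ^ n) (+-monoʳ-≤ (toℕ p) pq) ⟩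
    toℕ p + 2 ^ n + 2 ^ n                 ≡⟨ +-assoc (toℕ p) (2 ^ n) (2 ^ n) ⟩
    toℕ p + (2 ^ n + 2 ^ n)               ≡⟨ cong (toℕ p +_) (2^n+2^n n) ⟩
    toℕ p + 2 ^ suc n                     ≤⟨ safe ⟩
    2 ^ d                                 ∎
    where open ≤-Reasoning

  sinkSafe-origin : ∀ {n β} α → n ≤ d → SinkSafe n (pair α β zero)
  sinkSafe-origin zero    n≤d = ^-monoʳ-≤ 2 n≤d
  sinkSafe-origin (suc _) _   = tt

  sinkSafe-off : ∀ {n β p} α → α ≢ zero → SinkSafe n (pair α β p)
  sinkSafe-off zero    α≢0 = ⊥-elim (α≢0 refl)
  sinkSafe-off (suc _) _   = tt

  end-unsafe : ∀ {n α β p} → SinkSafe n (pair α β p) → toℕ p ≡ end → α ≢ zero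
  end-unsafe {p = p} safe p-end refl = <-irrefl refl (subst (_≤ 2 ^ d) p-end (m+n≤o⇒m≤o (toℕ p) safe))

  compatible-shift : ∀ {n π α β p q} → Close n p q →
                     Compatible (suc n) π (pair α β p) → Compatible n π (pair α β q)
  compatible-shift {π = π} {α} {β} pq (compatible coh safe) =
    compatible (λ {w} w<V → coherent-shift (π w) pq (coh w<V)) (sinkSafe-shift α β pq safe)

  compatible-roots : ∀ {n π} → Compatible n π roots
  compatible-roots = compatible (λ _ → tt) tt

  compatible-weaken : ∀ {n π} P → Compatible (suc n) π P → Compatible n π P
  compatible-weaken roots        _ = compatible-roots
  compatible-weaken (pair _ _ p) c = compatible-shift (close-refl p) c

  compatible-update : ∀ {n π P Q} x → Compatible n π Q → Coherent n Q P → Compatible n (π [ x ↦ P ]) Q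
  compatible-update {n} {π} {P} {Q} x (compatible coh safe) QP = compatible coh′ safe
    where
    coh′ : ∀ {w} → w < V → Coherent n Q ((π [ x ↦ P ]) w)
    coh′ {w} w<V with w ℕ.≟ x
    ... | yes _ = QP
    ... | no _  = coh w<V

  good-update : ∀ {n π P} x → Good (suc n) π → Compatible n π P → Good n (π [ x ↦ P ])
  good-update {π = π} {P} x good c {v} v<V with v ℕ.≟ x
  ... | yes _ = compatible-update x c (coherent-refl P)
  ... | no _  =
    compatible-update x (compatible-weaken (π v) (good v<V)) (coherent-sym P (π v) (Compatible.coherent c v<V))

  NearX NearY : ℕ → Branch → Pos → Match → Set
  NearX _ _ _ roots          = ⊥
  NearX n α p (pair α′ _ q)  = α′ ≡ α × Close n q p
  NearY _ _ _ roots          = ⊥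
  NearY n β p (pair _ β′ q)  = β′ ≡ β × Close n q p

  nearX? : ∀ n α p Q → Dec (NearX n α p Q)
  nearX? _ _ _ roots         = no λ ()
  nearX? n α p (pair α′ _ q) = (α′ Fin.≟ α) ×-dec close? n q p

  nearY? : ∀ n β p Q → Dec (NearY n β p Q)
  nearY? _ _ _ roots         = no λ ()
  nearY? n β p (pair _ β′ q) = (β′ Fin.≟ β) ×-dec close? n q p

  -- zero on roots is harmless: fresh branches avoid zero anyway.
  branchX branchY : Match → Branch
  branchX roots        = zero
  branchX (pair α _ _) = α
  branchY roots        = zero
  branchY (pair _ β _) = β

  fresh-branch : (branch : Var → Branch) → Σ Branch λ β → β ≢ zero × (∀ {w} → w < V → branch w ≢ β)
  fresh-branch branch with β , missed ← missed-point (n<1+n (suc V)) (zero ∷ branch ∘ toℕ) =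
    β , (λ β≡0 → missed zero (sym β≡0)) ,
    λ {w} w<V eq → missed (suc (fromℕ< w<V)) (trans (cong branch (toℕ-fromℕ< w<V)) eq)

  partnerY : ∀ {n π} → n ≤ d → Good (suc n) π → ∀ α → Σ Branch λ β → Compatible n π (pair α β zero)
  partnerY {n} {π} n≤d good α with anyUpTo? (λ w → nearX? n α zero (π w)) V
  ... | yes (w , w<V , near) = inherit (π w) near (good w<V)
    where
    inherit : ∀ Q → NearX n α zero Q → Compatible (suc n) π Q → Σ Branch λ β → Compatible n π (pair α β zero)
    inherit (pair _ β _) (refl , qp) c = β , compatible-shift qp c
  ... | no ¬near with β , _ , fresh ← fresh-branch (branchY ∘ π) =
    β , compatible (λ {w} w<V → apart (π w) (λ near → ¬near (w , w<V , near)) (fresh w<V))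
                   (sinkSafe-origin α n≤d)
    where
    apart : ∀ Q → ¬ NearX n α zero Q → branchY Q ≢ β → Coherent n (pair α β zero) Q
    apart roots          _     _   = tt
    apart (pair _ _ _) ¬near′ β′≢β pq =
      mk⇔ (λ { refl → ⊥-elim (¬near′ (refl , close-sym pq)) }) (λ { refl → ⊥-elim (β′≢β refl) })

  partnerX : ∀ {n π} → Good (suc n) π → ∀ β p → Σ Branch λ α → Compatible n π (pair α β p)
  partnerX {n} {π} good β p with anyUpTo? (λ w → nearY? n β p (π w)) V
  ... | yes (w , w<V , near) = inherit (π w) near (good w<V)
    where
    inherit : ∀ Q → NearY n β p Q → Compatible (suc n) π Q → Σ Branch λ α → Compatible n π (pair α β p)
    inherit (pair α _ _) (refl , qp) c = α , compatible-shift qp c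
  ... | no ¬near with α , α≢0 , fresh ← fresh-branch (branchX ∘ π) =
    α , compatible (λ {w} w<V → apart (π w) (λ near → ¬near (w , w<V , near)) (fresh w<V))
                   (sinkSafe-off α α≢0)
    where
    apart : ∀ Q → ¬ NearY n β p Q → branchX Q ≢ α → Coherent n (pair α β p) Q
    apart roots          _     _   = tt
    apart (pair _ _ _) ¬near′ α′≢α pq =
      mk⇔ (λ { refl → ⊥-elim (α′≢α refl) }) (λ { refl → ⊥-elim (¬near′ (refl , close-sym pq)) })

  forth-move : ∀ {n π a u} → n ≤ d → Good (suc n) π → ∀ Q → Compatible (suc n) π Q →
               Edge X-loops a (inX Q) u →
               Σ Match λ P → inX P ≡ u × Edge Y-loops a (inY Q) (inY P) × Compatible n π P
  forth-move n≤d good roots _ (S-root {b = α}) with β , c ← partnerY n≤d good α =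
    pair α β zero , refl , S-root , c
  forth-move _ _ (pair α β p) c (S-step e)  = pair α β _ , refl , S-step e , compatible-shift (close-adjacent e) c
  forth-move _ _ (pair α β p) c (S-loop e _) = pair α β p , refl , S-loop e tt , compatible-weaken _ c
  forth-move _ _ (pair α β zero) c B-root   = roots , refl , B-root , compatible-roots
  forth-move _ _ (pair α β p) c (B-step e)  =
    pair α β _ , refl , B-step e , compatible-shift (close-sym (close-adjacent e)) c

  back-move : ∀ {n π a u} → Good (suc n) π → ∀ Q → Compatible (suc n) π Q →
              Edge Y-loops a (inY Q) u →
              Σ Match λ P → inY P ≡ u × Edge X-loops a (inX Q) (inX P) × Compatible n π P
  back-move good roots _ (S-root {b = β}) with α , c ← partnerX good β zero =
    pair α β zero , refl , S-root , c
  back-move _ (pair α β p) c (S-step e)  = pair α β _ , refl , S-step e , compatible-shift (close-adjacent e) c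
  back-move _ (pair α β p) c (S-loop e _) =
    pair α β p , refl , S-loop e (end-unsafe (Compatible.sinkSafe c) e) , compatible-weaken _ c
  back-move _ (pair α β zero) c B-root   = roots , refl , B-root , compatible-roots
  back-move _ (pair α β p) c (B-step e)  =
    pair α β _ , refl , B-step e , compatible-shift (close-sym (close-adjacent e)) c

  back-any-move : ∀ {n π} → Good (suc n) π → ∀ u → Σ Match λ P → inY P ≡ u × Compatible n π P
  back-any-move _    root     = roots , refl , compatible-roots
  back-any-move good (at β p) with α , c ← partnerX good β p = pair α β p , refl , c

  edge-X⇒Y : ∀ {n a} P Q → Coherent n P Q → Edge X-loops a (inX P) (inX Q) → Edge Y-loops a (inY P) (inY Q)
  edge-X⇒Y roots (pair _ _ zero) _ S-root = S-root
  edge-X⇒Y (pair _ _ p) (pair _ _ q) coh (S-step e)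
    with refl ← Equivalence.to (coh (close-adjacent e)) refl = S-step e
  edge-X⇒Y (pair _ _ p) (pair _ _ _) coh (S-loop e _)
    with refl ← Equivalence.to (coh (close-refl p)) refl = S-loop e tt
  edge-X⇒Y (pair _ _ zero) roots _ B-root = B-root
  edge-X⇒Y (pair _ _ p) (pair _ _ q) coh (B-step e)
    with refl ← Equivalence.to (coh (close-sym (close-adjacent e))) refl = B-step e

  edge-Y⇒X : ∀ {n a} P Q → Coherent n P Q → SinkSafe n P → Edge Y-loops a (inY P) (inY Q) →
             Edge X-loops a (inX P) (inX Q)
  edge-Y⇒X roots (pair _ _ zero) _ _ S-root = S-root
  edge-Y⇒X (pair _ _ p) (pair _ _ q) coh _ (S-step e)
    with refl ← Equivalence.from (coh (close-adjacent e)) refl = S-step e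
  edge-Y⇒X (pair _ _ p) (pair _ _ _) coh safe (S-loop e _)
    with refl ← Equivalence.from (coh (close-refl p)) refl = S-loop e (end-unsafe safe e)
  edge-Y⇒X (pair _ _ zero) roots _ _ B-root = B-root
  edge-Y⇒X (pair _ _ p) (pair _ _ q) coh _ (B-step e)
    with refl ← Equivalence.from (coh (close-sym (close-adjacent e))) refl = B-step e

  point-eq-agree : ∀ {n} P Q → Coherent n P Q → (inX P ≡ inX Q) ⇔ (inY P ≡ inY Q)
  point-eq-agree roots        roots        _   = mk⇔ (λ _ → refl) (λ _ → refl)
  point-eq-agree roots        (pair _ _ _) _   = mk⇔ (λ ()) (λ ())
  point-eq-agree (pair _ _ _) roots        _   = mk⇔ (λ ()) (λ ())
  point-eq-agree (pair _ _ p) (pair _ _ _) coh =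
    mk⇔ (λ { refl → cong (λ b → at b p) (Equivalence.to (coh (close-refl p)) refl) })
        (λ { refl → cong (λ b → at b p) (Equivalence.from (coh (close-refl p)) refl) })

  Tracks : (Var → Fin (suc N)) → (Match → Point) → (Var → Match) → Set
  Tracks ρ side π = ∀ {v} → v < V → decode (ρ v) ≡ side (π v)

  tracks-update : ∀ {ρ π u P} x side → Tracks ρ side π → decode u ≡ side P →
                  Tracks (ρ [ x ↦ u ]) side (π [ x ↦ P ])
  tracks-update x _ tracks eq {v} v<V with v ℕ.≟ x
  ... | yes _ = eq
  ... | no _  = tracks v<V

  record Invariant (n : ℕ) (ρ σ : Var → Fin (suc N)) : Set where
    field
      n≤d     : n ≤ d
      match   : Var → Match
      tracksX : Tracks ρ inX match
      tracksY : Tracks σ inY match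
      good    : Good n match

  invariant-initial : Invariant d (λ _ → zero) (λ _ → zero)
  invariant-initial = record
    { n≤d     = ≤-refl
    ; match   = λ _ → roots
    ; tracksX = λ _ → refl
    ; tracksY = λ _ → refl
    ; good    = λ _ → compatible-roots
    }

  invariant-update : ∀ {n ρ σ u u′ P} x (inv : Invariant (suc n) ρ σ) → Compatible n (Invariant.match inv) P →
                     decode u ≡ inX P → decode u′ ≡ inY P → Invariant n (ρ [ x ↦ u ]) (σ [ x ↦ u′ ])
  invariant-update x inv c eqX eqY = record
    { n≤d     = ≤-trans (n≤1+n _) n≤d
    ; match   = match [ x ↦ _ ]
    ; tracksX = tracks-update x inX tracksX eqX
    ; tracksY = tracks-update x inY tracksY eqY
    ; good    = good-update x good c
    }
    where open Invariant inv

  simulation : ExistsBoundedSimulation X Y V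
  simulation = record
    { Inv       = Invariant
    ; rel-agree = rel-agree
    ; eq-agree  = eq-agree
    ; forth     = forth
    ; back      = back
    ; back-any  = back-any
    }
    where
    open Invariant
    open Compatible

    rel-agree : ∀ {n ρ σ x y} a → Invariant n ρ σ → x < V → y < V → Succ X a (ρ x) (ρ y) ⇔ Succ Y a (σ x) (σ y)
    rel-agree a inv x<V y<V =
      ⇔.trans (succ⇔edge X-loops? a (tracksX inv x<V) (tracksX inv y<V))
        (⇔.trans (mk⇔ (edge-X⇒Y _ _ (coherent c y<V)) (edge-Y⇒X _ _ (coherent c y<V) (sinkSafe c)))
          (⇔.sym (succ⇔edge Y-loops? a (tracksY inv x<V) (tracksY inv y<V))))
      where
      c = good inv x<V

    eq-agree : ∀ {n ρ σ x y} → Invariant n ρ σ → x < V → y < V → (ρ x ≡ ρ y) ⇔ (σ x ≡ σ y)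
    eq-agree inv x<V y<V =
      ⇔.trans (decode-≡⇔ (tracksX inv x<V) (tracksX inv y<V))
        (⇔.trans (point-eq-agree _ _ (coherent (good inv x<V) y<V))
          (⇔.sym (decode-≡⇔ (tracksY inv x<V) (tracksY inv y<V))))

    forth : ∀ {n ρ σ y u} x a → Invariant (suc n) ρ σ → y < V → Succ X a (ρ y) u →
            Σ (W Y) λ u′ → Succ Y a (σ y) u′ × Invariant n (ρ [ x ↦ u ]) (σ [ x ↦ u′ ])
    forth x a inv y<V r
      with P , eqX , edge , c ←
             forth-move (≤-trans (n≤1+n _) (n≤d inv)) (good inv) (match inv _) (good inv y<V)
                        (Equivalence.to (succ⇔edge X-loops? a (tracksX inv y<V) refl) r) =
      encode (inY P) , Equivalence.from (succ⇔edge Y-loops? a (tracksY inv y<V) (decode-encode _)) edge ,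
      invariant-update x inv c (sym eqX) (decode-encode _)

    back : ∀ {n ρ σ y u′} x a → Invariant (suc n) ρ σ → y < V → Succ Y a (σ y) u′ →
           Σ (W X) λ u → Succ X a (ρ y) u × Invariant n (ρ [ x ↦ u ]) (σ [ x ↦ u′ ])
    back x a inv y<V r
      with P , eqY , edge , c ←
             back-move (good inv) (match inv _) (good inv y<V)
                       (Equivalence.to (succ⇔edge Y-loops? a (tracksY inv y<V) refl) r) =
      encode (inX P) , Equivalence.from (succ⇔edge X-loops? a (tracksX inv y<V) (decode-encode _)) edge ,
      invariant-update x inv c (decode-encode _) (sym eqY)

    back-any : ∀ {n ρ σ} x u′ → Invariant (suc n) ρ σ → Σ (W X) λ u → Invariant n (ρ [ x ↦ u ]) (σ [ x ↦ u′ ])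
    back-any x u′ inv with P , eqY , c ← back-any-move (good inv) (decode u′) =
      encode (inX P) , invariant-update x inv c (decode-encode _) (sym eqY)

-- ⊨ evaluates under a fixed assignment, so ψ need not be a sentence.
χ-not-existsBounded : (ψ : Formula 2) → Sentence ψ → ExistsBounded ψ → ¬ EquivalentOverFiniteFrames χ ψ
χ-not-existsBounded ψ _ eb χ⇔ψ with V , vars ← varsBelow-exists ψ =
  Y⊭χ (Equivalence.from (χ⇔ψ Y)
    (ExistsBoundedSimulation.preserves simulation eb ≤-refl vars invariant-initial
      (Equivalence.to (χ⇔ψ X) X⊨χ)))
  where
  open Branches (depth ψ) V

theorem3p10 : Σ ℕ λ k → Σ (Formula k) λ χ →
                Sentence χ
                × PreservedUnderGeneratedSubframes χ
                × ((ψ : Formula k) → Sentence ψ → ExistsBounded ψ →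
                     ¬ EquivalentOverFiniteFrames χ ψ)
theorem3p10 = 2 , χ , χ-sentence , χ-preserved , χ-not-existsBounded
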